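{- Let $\varepsilon$ be $1$-symmetric and suppose that there exists $J \in \mathcal P_\star(S_n)$ such that $|S_n \setminus J|$ is even, $\mathcal D_0 := \mathcal P_1(S_n) \cup \{S_n\setminus J\} \subseteq \mathcal D$, and the restriction of $\varepsilon$ to $\mathcal D_0$ is constant, say equal to $\varepsilon_0$. Then $p_2 = 3$ and $\alpha_2 \ge \frac12(5 - \varepsilon_0)$.
   Context: Standing setting: $n \ge 3$ is an integer, $S_n = \{1,\ldots,n\}$; for a set $X$, $\mathcal P_\star(X)$ is the family of finite nonempty proper subsets of $X$ and $\mathcal P_k(X)$ the family of $k$-element subsets. Let $p_1 < p_2 < \cdots < p_n$ be primes, $\mathfrak P = \{p_1,\ldots,p_n\}$, $v_1,\ldots,v_n$ positive integers, $\mathcal D$ a nonempty subfamily of $\mathcal P_\star(S_n)$, and $\varepsilon:\mathcal P_\star(S_n)\to\{\pm1\}$ a map, with $\varepsilon_I := \varepsilon(I)$. Standing hypothesis: every prime $q$ dividing $\prod_{i\in I} p_i^{v_i} - \varepsilon_I$ for some $I \in \mathcal D$ belongs to $\mathfrak P$. Notation: $\mathcal D^{\mathrm{op}} := \{S_n\setminus I : I \in \mathcal D\}$; for $I \in \mathcal P_\star(S_n)$, $P_I := \prod_{i\in I} p_i^{v_i}$, $P_{ -I} := P_{S_n\setminus I}$, $\varepsilon_{ -I} := \varepsilon_{S_n\setminus I}$; for $i\in S_n$, $P_{ -i} := P_{ -\{i\}}$, $\varepsilon_{ -i} := \varepsilon_{ -\{i\}}$. For $I \in \mathcal D^{\mathrm{op}}$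 and $i\in I$, $\alpha_{i,I}$ denotes the exponent of $p_i$ in the positive integer $P_{ -I} - \varepsilon_{ -I}$; under the standing hypothesis $P_{ -I} = \varepsilon_{ -I} + \prod_{i\in I} p_i^{\alpha_{i,I}}$. For $\{i\}\in\mathcal D^{\mathrm{op}}$, $\alpha_i := \alpha_{i,\{i\}}$, so $P_{ -i} = p_i^{\alpha_i} + \varepsilon_{ -i}$. The map $\varepsilon$ is called $1$-symmetric if (i) every $I \in \mathcal D$ with $|I| = 1$ belongs to $\mathcal D^{\mathrm{op}}$, and (ii) $\varepsilon_I = \varepsilon_{ -I}$ for every $I \in \mathcal D$ with $|I| = 1$. -}

module Defs where

open import Data.Nat using (ℕ; zero; suc; _*_; _^_; _≤_; s≤s; z≤n)
open import Data.Nat.Divisibility using (_∣_)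
open import Data.Bool using (if_then_else_)
open import Data.Fin using (Fin; zero; suc)
open import Data.Fin.Subset using (Subset; Nonempty; ∁)
open import Data.Vec using (lookup)
open import Data.Integer using (ℤ; +_; _-_; _◃_)
open import Data.Sign using (Sign)
open import Data.Product using (_×_)
open import Relation.Nullary using (¬_)

prodFin : ∀ {n} → (Fin n → ℕ) → ℕ
prodFin {zero}  f = 1
prodFin {suc n} f = f zero * prodFin (λ i → f (suc i))

P : ∀ {n} → (Fin n → ℕ) → (Fin n → ℕ) → Subset n → ℕ
P p v I = prodFin (λ i → if lookup I i then p i ^ v i else 1)

sgn : Sign → ℤ
sgn s = s ◃ 1

Pminus : ∀ {n} → (Fin n → ℕ) → (Fin n → ℕ) → (Subset n → Sign) → Subset n → ℤ
Pminus p v ε I = + P p v I - sgn (ε I)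

NonemptyProper : ∀ {n} → Subset n → Set
NonemptyProper I = Nonempty I × Nonempty (∁ I)

IsExponent : ℕ → ℕ → ℕ → Set
IsExponent p a m = (p ^ a ∣ m) × ¬ (p ^ suc a ∣ m)

-- the index "2" (1-based) in S_n, n ≥ 3
second : ∀ {n} → 3 ≤ n → Fin n
second (s≤s (s≤s (s≤s _))) = suc zero

module Submission where

-- Notation: aᵢ = pᵢ^vᵢ, P₋ᵢ = ∏_{j ≠ i} aⱼ, and gap x ε = |x - ε| for a sign ε.
-- By 1-symmetry all singletons {i}, all co-singletons S_n ∖ {i} and ∁J lie in D, with
-- the common sign ε₀.  Since pⱼ ∣ P₋ᵢ for j ≠ i, the only prime that can divide
-- |P₋ᵢ - ε₀| is pᵢ, so |P₋ᵢ - ε₀| is a power of pᵢ.  The proof then runs: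
--   * p₁ = 2: one of a₁ and |a₁ - ε₀| is even, so 2 ∈ 𝔓, and p₁ is the least element.
--   * p₂ = 3: otherwise 3 ∉ 𝔓, so 3 divides none of aᵢ, |aᵢ - ε₀|, |P_{∁J} - ε₀|.
--     For ε₀ = +1 every aᵢ ≡ 2 (mod 3), so P_{∁J} ≡ 2^{|∁J|} ≡ 1 (mod 3): absurd.
--     For ε₀ = -1 every aᵢ ≡ 1 (mod 3); then P₋ᵢ + 1 = pᵢ^e ≡ 2 (mod 3) gives
--     pᵢ ≡ 2 (mod 3), so every vᵢ is even, aᵢ ≡ 1 (mod 8) for i ≥ 2, and P₋₁ + 1 would
--     be a power of 2 that is ≡ 2 (mod 8) yet at least 4: absurd.
--   * |P₋₂ - ε₀| = 3^α with P₋₂ ≥ p₃ ≥ 5 and P₋₂ ≠ 8, forcing 2α ≥ 5 - ε₀.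

open import Defs
open import Data.Nat using (ℕ; _≤_; _<_)
open import Data.Nat.Divisibility using (_∣_)
open import Data.Nat.Primality using (Prime)
open import Data.Fin using (Fin) renaming (_<_ to _<ᶠ_)
open import Data.Fin.Subset using (Subset; ∁; ⁅_⁆; ∣_∣)
open import Data.Integer using (ℤ; +_; _-_; ∣_∣) renaming (_≤_ to _≤ℤ_; _*_ to _*ℤ_)
open import Data.Sign using (Sign)
open import Data.Product using (_×_; ∃; _,_)
open import Relation.Binary.PropositionalEquality using (_≡_)

open import Data.Nat using (zero; suc; pred; _+_; _*_; _∸_; _^_; _%_; z≤n; s≤s; NonZero; >-nonZero; nonTrivial⇒n>1)
open import Data.Nat.Properties
  using ( ≤-refl; ≤-trans; ≤-antisym; <⇒≤; <⇒≢; <⇒≱; ≮⇒≥; ≤∧≢⇒<; m≤n+m; pred-mono-≤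
        ; suc-injective; +-comm; *-identityˡ; *-identityʳ; *-monoʳ-≤; *-comm; *-assoc; *-mono-≤; m+[n∸m]≡n
        ; ^-zeroˡ; ^-distribˡ-+-*; ^-*-assoc; ^-monoʳ-<; m^n>0; m^n≢0; _≟_ )
open import Data.Nat.Divisibility
  using (divides; ∣-trans; _∣?_; ∣⇒≤; ∣1⇒≡1; m∣m*n; ∣n⇒∣m*n; ∣m+n∣m⇒∣n; ∣n∣m%n⇒∣m; m%n≡0⇒n∣m; n∣m⇒m%n≡0)
open import Data.Nat.DivMod using (_/_; m≡m%n+[m/n]*n; m%n<n; m%n%n≡m%n; %-distribˡ-+; %-distribˡ-*)
open import Data.Nat.Primality
  using (¬prime[1]; prime[2]; prime?; euclidsLemma; prime⇒irreducible; prime⇒nonTrivial)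
open import Data.Nat.Primality.Factorisation using (factorise; PrimeFactorisation)
open import Data.Nat.ListAction using (product)
open import Data.List using ([]; _∷_; length)
open import Data.List.Relation.Unary.All using (All; []; _∷_)
open import Data.Fin using (zero; suc) renaming (_≟_ to _≟ᶠ_)
open import Data.Fin.Subset using (_∈_; inside; outside) renaming (⊥ to ∅)
open import Data.Fin.Subset.Properties using (x∈⁅x⁆; x≢y⇒x∉⁅y⁆; x∉p⇒x∈∁p; x∈∁p⇒x∉p; ∣⁅x⁆∣≡1)
open import Data.Vec using ([]; _∷_; here; there)
open import Data.Integer using (+≤+)
open import Data.Bool using (if_then_else_)
open import Data.Integer.Properties using (pos-*)
open import Data.Sign as Sign using ()
open import Data.Sum using (_⊎_; inj₁; inj₂)
open import Data.Empty using (⊥; ⊥-elim)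
open import Function using (_∘_)
open import Relation.Nullary using (¬_; yes; no; contradiction)
open import Relation.Nullary.Decidable using (toWitness)
open import Relation.Binary.PropositionalEquality using (_≢_; refl; sym; trans; cong; cong₂; subst; subst₂; module ≡-Reasoning)

prime≥2 : ∀ {p} → Prime p → 2 ≤ p
prime≥2 {p} p-prime = nonTrivial⇒n>1 p {{prime⇒nonTrivial p-prime}}

prime∤1 : ∀ {q} → Prime q → ¬ q ∣ 1
prime∤1 q-prime q∣1 = ¬prime[1] (subst Prime (∣1⇒≡1 q∣1) q-prime)

prime∣prime⇒≡ : ∀ {q p} → Prime q → Prime p → q ∣ p → q ≡ p
prime∣prime⇒≡ q-prime p-prime q∣p with prime⇒irreducible p-prime q∣p
... | inj₁ q≡1 = ⊥-elim (¬prime[1] (subst Prime q≡1 q-prime))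
... | inj₂ q≡p = q≡p

prime∣^⇒∣ : ∀ {q} x k → Prime q → q ∣ x ^ k → q ∣ x
prime∣^⇒∣ x zero    q-prime q∣1 = ⊥-elim (prime∤1 q-prime q∣1)
prime∣^⇒∣ x (suc k) q-prime q∣x*xᵏ with euclidsLemma x (x ^ k) q-prime q∣x*xᵏ
... | inj₁ q∣x  = q∣x
... | inj₂ q∣xᵏ = prime∣^⇒∣ x k q-prime q∣xᵏ

prime[3] : Prime 3
prime[3] = toWitness {a? = prime? 3} _

product≡power : ∀ {p} xs → All Prime xs → (∀ q → Prime q → q ∣ product xs → q ≡ p)
  → product xs ≡ p ^ length xs
product≡power []       []             only-p = refl
product≡power (x ∷ xs) (x-prime ∷ xs-prime) only-p =
  cong₂ _*_ (only-p x x-prime (m∣m*n (product xs)))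
            (product≡power xs xs-prime (λ q q-prime q∣ → only-p q q-prime (∣n⇒∣m*n x q∣)))

only-prime-divisor⇒power : ∀ {p} n .{{_ : NonZero n}} → (∀ q → Prime q → q ∣ n → q ≡ p)
  → ∃ λ e → n ≡ p ^ e
only-prime-divisor⇒power n only-p =
  length (factors f) , trans n≡∏ (product≡power (factors f) (factorsPrime f)
                                   (λ q q-prime q∣ → only-p q q-prime (subst (q ∣_) (sym n≡∏) q∣)))
  where
  open PrimeFactorisation using (factors; factorsPrime; isFactorisation)
  f : PrimeFactorisation n
  f = factorise n
  n≡∏ : n ≡ product (factors f)
  n≡∏ = isFactorisation f

^-monoʳ-∣ : ∀ p {m n} → m ≤ n → p ^ m ∣ p ^ n
^-monoʳ-∣ p {m} {n} m≤n =
  subst (p ^ m ∣_) (trans (sym (^-distribˡ-+-* p m (n ∸ m))) (cong (p ^_) (m+[n∸m]≡n m≤n)))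
        (m∣m*n (p ^ (n ∸ m)))

exponent-of-power : ∀ {p α e} → 1 < p → IsExponent p α (p ^ e) → α ≡ e
exponent-of-power {p} {α} {e} 1<p (pᵅ∣pᵉ , pᵅ⁺¹∤pᵉ) = ≤-antisym α≤e e≤α
  where
  instance
    p≢0 : NonZero p
    p≢0 = >-nonZero (≤-trans (s≤s z≤n) 1<p)
  α≤e : α ≤ e
  α≤e = ≮⇒≥ λ e<α → <⇒≱ (^-monoʳ-< p 1<p e<α) (∣⇒≤ {{m^n≢0 p e}} pᵅ∣pᵉ)
  e≤α : e ≤ α
  e≤α = ≮⇒≥ λ α<e → pᵅ⁺¹∤pᵉ (^-monoʳ-∣ p α<e)

%-+-cong : ∀ m .{{_ : NonZero m}} {x x′ y y′} → x % m ≡ x′ % m → y % m ≡ y′ % m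
  → (x + y) % m ≡ (x′ + y′) % m
%-+-cong m {x} {x′} {y} {y′} x≡x′ y≡y′ = begin
  (x + y) % m               ≡⟨ %-distribˡ-+ x y m ⟩
  (x % m + y % m) % m       ≡⟨ cong₂ (λ r s → (r + s) % m) x≡x′ y≡y′ ⟩
  (x′ % m + y′ % m) % m     ≡⟨ sym (%-distribˡ-+ x′ y′ m) ⟩
  (x′ + y′) % m             ∎
  where open ≡-Reasoning

%-*-cong : ∀ m .{{_ : NonZero m}} {x x′ y y′} → x % m ≡ x′ % m → y % m ≡ y′ % m
  → (x * y) % m ≡ (x′ * y′) % m
%-*-cong m {x} {x′} {y} {y′} x≡x′ y≡y′ = begin
  (x * y) % m               ≡⟨ %-distribˡ-* x y m ⟩
  (x % m * (y % m)) % m     ≡⟨ cong₂ (λ r s → (r * s) % m) x≡x′ y≡y′ ⟩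
  (x′ % m * (y′ % m)) % m   ≡⟨ sym (%-distribˡ-* x′ y′ m) ⟩
  (x′ * y′) % m             ∎
  where open ≡-Reasoning

%-^-cong : ∀ m .{{_ : NonZero m}} {x y} k → x % m ≡ y % m → (x ^ k) % m ≡ (y ^ k) % m
%-^-cong m zero    x≡y = refl
%-^-cong m (suc k) x≡y = %-*-cong m x≡y (%-^-cong m k x≡y)

%≡1⇒^%≡1 : ∀ m .{{_ : NonZero m}} {x} k → x % m ≡ 1 % m → (x ^ k) % m ≡ 1 % m
%≡1⇒^%≡1 m {x} k x≡1 = trans (%-^-cong m k x≡1) (cong (_% m) (^-zeroˡ k))

residue-mod3 : ∀ x → x % 3 ≡ 0 ⊎ x % 3 ≡ 1 ⊎ x % 3 ≡ 2
residue-mod3 x with x % 3 | m%n<n x 3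
... | 0 | _ = inj₁ refl
... | 1 | _ = inj₂ (inj₁ refl)
... | 2 | _ = inj₂ (inj₂ refl)
... | suc (suc (suc _)) | s≤s (s≤s (s≤s ()))

even⇒2^%3≡1 : ∀ v → 2 ∣ v → (2 ^ v) % 3 ≡ 1
even⇒2^%3≡1 v (divides h refl) =
  subst (λ e → (2 ^ e) % 3 ≡ 1) (*-comm 2 h) (subst (λ x → x % 3 ≡ 1) (^-*-assoc 2 2 h) (%≡1⇒^%≡1 3 h refl))

-- since 4 ≡ 1 (mod 3), the residue of 2^v mod 3 only depends on the parity of v
2^[2+v]%3 : ∀ v → (2 ^ (2 + v)) % 3 ≡ (2 ^ v) % 3
2^[2+v]%3 v = begin
  (2 * (2 * 2 ^ v)) % 3   ≡⟨ cong (_% 3) (sym (*-assoc 2 2 (2 ^ v))) ⟩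
  (4 * 2 ^ v) % 3         ≡⟨ %-*-cong 3 {4} {1} {2 ^ v} {2 ^ v} refl refl ⟩
  (1 * 2 ^ v) % 3         ≡⟨ cong (_% 3) (*-identityˡ (2 ^ v)) ⟩
  (2 ^ v) % 3             ∎
  where open ≡-Reasoning

2^%3≡1⇒even : ∀ v → (2 ^ v) % 3 ≡ 1 → 2 ∣ v
2^%3≡1⇒even zero          _ = divides 0 refl
2^%3≡1⇒even (suc zero)    ()
2^%3≡1⇒even (suc (suc v)) 2^[2+v]≡1 with 2^%3≡1⇒even v (trans (sym (2^[2+v]%3 v)) 2^[2+v]≡1)
... | divides h v≡h*2 = divides (suc h) (cong (λ w → 2 + w) v≡h*2)

odd²%8≡1 : ∀ x → ¬ 2 ∣ x → (x ^ 2) % 8 ≡ 1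
odd²%8≡1 x x-odd =
  trans (%-^-cong 8 {x} {x % 8} 2 (sym (m%n%n≡m%n x 8)))
        (check (x % 8) (m%n<n x 8) (x-odd ∘ ∣n∣m%n⇒∣m (divides 4 refl)))
  where
  check : ∀ r → r < 8 → ¬ 2 ∣ r → (r ^ 2) % 8 ≡ 1
  check 0 _ r-odd = ⊥-elim (r-odd (divides 0 refl))
  check 1 _ _     = refl
  check 2 _ r-odd = ⊥-elim (r-odd (divides 1 refl))
  check 3 _ _     = refl
  check 4 _ r-odd = ⊥-elim (r-odd (divides 2 refl))
  check 5 _ _     = refl
  check 6 _ r-odd = ⊥-elim (r-odd (divides 3 refl))
  check 7 _ _     = refl
  check (suc (suc (suc (suc (suc (suc (suc (suc _))))))))
        (s≤s (s≤s (s≤s (s≤s (s≤s (s≤s (s≤s (s≤s ())))))))) _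

odd^even%8≡1 : ∀ x v → ¬ 2 ∣ x → 2 ∣ v → (x ^ v) % 8 ≡ 1
odd^even%8≡1 x v x-odd (divides h refl) =
  subst (λ e → (x ^ e) % 8 ≡ 1) (*-comm 2 h)
        (subst (λ y → y % 8 ≡ 1) (^-*-assoc x 2 h) (%≡1⇒^%≡1 8 h (odd²%8≡1 x x-odd)))

2^%8≡2⇒≡1 : ∀ e → (2 ^ e) % 8 ≡ 2 → e ≡ 1
2^%8≡2⇒≡1 0 ()
2^%8≡2⇒≡1 1 _ = refl
2^%8≡2⇒≡1 2 ()
2^%8≡2⇒≡1 (suc (suc (suc j))) 2^e≡2
  with trans (sym (n∣m⇒m%n≡0 (2 ^ (3 + j)) 8 (^-monoʳ-∣ 2 {3} {3 + j} (s≤s (s≤s (s≤s z≤n)))))) 2^e≡2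
... | ()

parity : ∀ x → (2 ∣ x) ⊎ (2 ∣ suc x)
parity zero    = inj₁ (divides 0 refl)
parity (suc x) with parity x
... | inj₁ (divides h x≡2h) = inj₂ (divides (suc h) (cong (λ w → 2 + w) x≡2h))
... | inj₂ 2∣1+x            = inj₁ 2∣1+x

-- The distance |x - ε| from a natural number to a sign; by definition
-- ∣ Pminus p v ε I ∣ is gap (P p v I) (ε I).

gap : ℕ → Sign → ℕ
gap x s = Data.Integer.∣ + x - sgn s ∣

gap-minus : ∀ x → gap x Sign.- ≡ suc x
gap-minus x = +-comm x 1

gap≥pred : ∀ x s → pred x ≤ gap x s
gap≥pred zero    s       = z≤n
gap≥pred (suc x) Sign.+ = ≤-refl
gap≥pred (suc x) Sign.- = subst (x ≤_) (sym (gap-minus (suc x))) (m≤n+m x 2)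

gap-coprime : ∀ {d} x s → d ∣ x → d ∣ gap x s → d ∣ 1
gap-coprime zero    Sign.+ _   d∣1 = d∣1
gap-coprime {d} (suc x) Sign.+ d∣x d∣gap = ∣m+n∣m⇒∣n (subst (d ∣_) (+-comm 1 x) d∣x) d∣gap
gap-coprime x       Sign.- d∣x d∣gap = ∣m+n∣m⇒∣n d∣gap d∣x

odd⇒2∣gap : ∀ x s → ¬ 2 ∣ x → 2 ∣ gap x s
odd⇒2∣gap x Sign.- x-odd with parity x
... | inj₁ 2∣x   = ⊥-elim (x-odd 2∣x)
... | inj₂ 2∣1+x = subst (2 ∣_) (sym (gap-minus x)) 2∣1+x
odd⇒2∣gap zero    Sign.+ x-odd = ⊥-elim (x-odd (divides 0 refl))
odd⇒2∣gap (suc x) Sign.+ x-odd with parity x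
... | inj₁ 2∣x   = 2∣x
... | inj₂ 2∣1+x = ⊥-elim (x-odd 2∣1+x)

%≡1⇒∣gap+ : ∀ m .{{_ : NonZero m}} x → x % m ≡ 1 → m ∣ gap x Sign.+
%≡1⇒∣gap+ (suc m) zero    ()
%≡1⇒∣gap+ (suc m) (suc x) x%m≡1 =
  divides (suc x / suc m)
    (suc-injective (trans (m≡m%n+[m/n]*n (suc x) (suc m)) (cong (_+ (suc x / suc m) * suc m) x%m≡1)))

%3≡2⇒3∣gap- : ∀ x → x % 3 ≡ 2 → 3 ∣ gap x Sign.-
%3≡2⇒3∣gap- x x%3≡2 =
  subst (3 ∣_) (sym (gap-minus x)) (m%n≡0⇒n∣m (suc x) 3 (%-+-cong 3 {1} {1} {x} {2} refl x%3≡2))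

+≤+2*ℤ : ∀ {m α} → m ≤ 2 * α → + m ≤ℤ + 2 *ℤ + α
+≤+2*ℤ {m} {α} m≤2α = subst (+ m ≤ℤ_) (pos-* 2 α) (+≤+ m≤2α)

3^α≥4⇒α≥2 : ∀ α → 4 ≤ 3 ^ α → 2 ≤ α
3^α≥4⇒α≥2 0             (s≤s ())
3^α≥4⇒α≥2 1             (s≤s (s≤s (s≤s ())))
3^α≥4⇒α≥2 (suc (suc α)) _ = s≤s (s≤s z≤n)

3^α≥6⇒α≥3 : ∀ α → 6 ≤ 3 ^ α → 3 ^ α ≢ 9 → 3 ≤ α
3^α≥6⇒α≥3 0                   (s≤s ()) _
3^α≥6⇒α≥3 1                   (s≤s (s≤s (s≤s ()))) _
3^α≥6⇒α≥3 2                   _ 3²≢9 = ⊥-elim (3²≢9 refl)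
3^α≥6⇒α≥3 (suc (suc (suc α))) _ _  = s≤s (s≤s (s≤s z≤n))

power-of-3-bound : ∀ x s α → 5 ≤ x → x ≢ 8 → gap x s ≡ 3 ^ α → + 5 - sgn s ≤ℤ + 2 *ℤ + α
power-of-3-bound x Sign.+ α 5≤x _ gap≡3ᵅ =
  +≤+2*ℤ {α = α} (*-monoʳ-≤ 2 (3^α≥4⇒α≥2 α (subst (4 ≤_) gap≡3ᵅ (≤-trans (pred-mono-≤ 5≤x) (gap≥pred x Sign.+)))))
power-of-3-bound x Sign.- α 5≤x x≢8 gap≡3ᵅ =
  +≤+2*ℤ {α = α} (*-monoʳ-≤ 2 (3^α≥6⇒α≥3 α (subst (6 ≤_) 1+x≡3ᵅ (s≤s 5≤x)) (x≢8 ∘ suc-injective ∘ trans 1+x≡3ᵅ)))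
  where
  1+x≡3ᵅ : suc x ≡ 3 ^ α
  1+x≡3ᵅ = trans (sym (gap-minus x)) gap≡3ᵅ

P-empty : ∀ {n} (p v : Fin n → ℕ) → P p v ∅ ≡ 1
P-empty {zero}  p v = refl
P-empty {suc n} p v = trans (*-identityˡ _) (P-empty (p ∘ suc) (v ∘ suc))

P-singleton : ∀ {n} (p v : Fin n → ℕ) i → P p v ⁅ i ⁆ ≡ p i ^ v i
P-singleton p v zero    = trans (cong (p zero ^ v zero *_) (P-empty (p ∘ suc) (v ∘ suc))) (*-identityʳ _)
P-singleton p v (suc i) = trans (*-identityˡ _) (P-singleton (p ∘ suc) (v ∘ suc) i)

P-positive : ∀ {n} (p v : Fin n → ℕ) I → (∀ i → 0 < p i) → 0 < P p v I
P-positive p v []           p>0 = s≤s z≤n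
P-positive p v (inside ∷ I) p>0 =
  *-mono-≤ (m^n>0 (p zero) {{>-nonZero (p>0 zero)}} (v zero)) (P-positive (p ∘ suc) (v ∘ suc) I (p>0 ∘ suc))
P-positive p v (outside ∷ I) p>0 =
  subst (0 <_) (sym (*-identityˡ _)) (P-positive (p ∘ suc) (v ∘ suc) I (p>0 ∘ suc))

P-∣ : ∀ {n} (p v : Fin n → ℕ) {I i} → i ∈ I → p i ^ v i ∣ P p v I
P-∣ p v           here        = m∣m*n _
P-∣ p v {b ∷ I}   (there i∈I) = ∣n⇒∣m*n (if b then p zero ^ v zero else 1) (P-∣ (p ∘ suc) (v ∘ suc) i∈I)

P-mod : ∀ {n} m .{{_ : NonZero m}} r (p v : Fin n → ℕ) I → (∀ i → i ∈ I → (p i ^ v i) % m ≡ r % m)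
  → P p v I % m ≡ (r ^ Data.Fin.Subset.∣ I ∣) % m
P-mod m r p v []            ≡r = refl
P-mod m r p v (inside ∷ I)  ≡r =
  %-*-cong m (≡r zero here) (P-mod m r (p ∘ suc) (v ∘ suc) I (λ i i∈I → ≡r (suc i) (there i∈I)))
P-mod m r p v (outside ∷ I) ≡r =
  trans (cong (_% m) (*-identityˡ _)) (P-mod m r (p ∘ suc) (v ∘ suc) I (λ i i∈I → ≡r (suc i) (there i∈I)))

P-mod-1 : ∀ {n} m .{{_ : NonZero m}} (p v : Fin n → ℕ) I → (∀ i → i ∈ I → (p i ^ v i) % m ≡ 1 % m)
  → P p v I % m ≡ 1 % m
P-mod-1 m p v I ≡1 = trans (P-mod m 1 p v I ≡1) (cong (_% m) (^-zeroˡ (Data.Fin.Subset.∣ I ∣)))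

-- The argument, under the hypotheses of the theorem (with n = 3 + k).  Indices are
-- 0-based in Agda: i₁, i₂, i₃ are the paper's indices 1, 2, 3.

module Setting
  (k : ℕ) (p v : Fin (3 + k) → ℕ) (D : Subset (3 + k) → Set) (ε : Subset (3 + k) → Sign)
  (p-prime : ∀ i → Prime (p i))
  (p-increasing : ∀ i j → i <ᶠ j → p i < p j)
  (v≥1 : ∀ i → 1 ≤ v i)
  (radical : ∀ I → D I → ∀ q → Prime q → q ∣ gap (P p v I) (ε I) → ∃ (λ i → q ≡ p i))
  (D-co : ∀ I → D I → Data.Fin.Subset.∣ I ∣ ≡ 1 → D (∁ I))
  (ε-co : ∀ I → D I → Data.Fin.Subset.∣ I ∣ ≡ 1 → ε I ≡ ε (∁ I))
  (J : Subset (3 + k)) (ε₀ : Sign)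
  (∁J-even : 2 ∣ Data.Fin.Subset.∣ ∁ J ∣)
  (D-singleton : ∀ i → D ⁅ i ⁆) (D-∁J : D (∁ J))
  (ε-singleton : ∀ i → ε ⁅ i ⁆ ≡ ε₀) (ε-∁J : ε (∁ J) ≡ ε₀)
  where

  i₁ i₂ i₃ : Fin (3 + k)
  i₁ = zero
  i₂ = suc zero
  i₃ = suc (suc zero)

  a : Fin (3 + k) → ℕ
  a i = p i ^ v i

  P₋ : Fin (3 + k) → ℕ
  P₋ i = P p v (∁ ⁅ i ⁆)

  p≥2 : ∀ i → 2 ≤ p i
  p≥2 i = prime≥2 (p-prime i)

  p₁-least : ∀ j → p i₁ ≤ p j
  p₁-least zero    = ≤-refl
  p₁-least (suc j) = <⇒≤ (p-increasing zero (suc j) (s≤s z≤n))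

  p∣a : ∀ i → p i ∣ a i
  p∣a i with v i | v≥1 i
  ... | suc w | _ = m∣m*n (p i ^ w)

  radical-singleton : ∀ i q → Prime q → q ∣ gap (a i) ε₀ → ∃ (λ j → q ≡ p j)
  radical-singleton i q q-prime q∣gap = radical ⁅ i ⁆ (D-singleton i) q q-prime
    (subst (q ∣_) (cong₂ gap (sym (P-singleton p v i)) (sym (ε-singleton i))) q∣gap)

  radical-∁J : ∀ q → Prime q → q ∣ gap (P p v (∁ J)) ε₀ → ∃ (λ j → q ≡ p j)
  radical-∁J q q-prime q∣gap =
    radical (∁ J) D-∁J q q-prime (subst (λ s → q ∣ gap (P p v (∁ J)) s) (sym ε-∁J) q∣gap)

  ε-co-singleton : ∀ i → ε (∁ ⁅ i ⁆) ≡ ε₀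
  ε-co-singleton i = trans (sym (ε-co ⁅ i ⁆ (D-singleton i) (∣⁅x⁆∣≡1 i))) (ε-singleton i)

  p∣P₋ : ∀ i j → j ≢ i → p j ∣ P₋ i
  p∣P₋ i j j≢i = ∣-trans (p∣a j) (P-∣ p v (x∉p⇒x∈∁p (x≢y⇒x∉⁅y⁆ j≢i)))

  p≤P₋ : ∀ i j → j ≢ i → p j ≤ P₋ i
  p≤P₋ i j j≢i = ∣⇒≤ {{>-nonZero (P-positive p v (∁ ⁅ i ⁆) (λ l → ≤-trans (s≤s z≤n) (p≥2 l)))}} (p∣P₋ i j j≢i)

  P₋≥2 : ∀ i → 2 ≤ P₋ i
  P₋≥2 zero    = ≤-trans (p≥2 i₂) (p≤P₋ zero i₂ λ ())
  P₋≥2 (suc i) = ≤-trans (p≥2 i₁) (p≤P₋ (suc i) i₁ λ ())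

  -- the only prime dividing |P₋ᵢ - ε₀| is pᵢ, since every other pⱼ divides P₋ᵢ
  radical-co-singleton : ∀ i q → Prime q → q ∣ gap (P₋ i) ε₀ → q ≡ p i
  radical-co-singleton i q q-prime q∣gap
    with radical (∁ ⁅ i ⁆) (D-co ⁅ i ⁆ (D-singleton i) (∣⁅x⁆∣≡1 i)) q q-prime
           (subst (λ s → q ∣ gap (P₋ i) s) (sym (ε-co-singleton i)) q∣gap)
  ... | j , refl with j ≟ᶠ i
  ...   | yes refl = refl
  ...   | no j≢i   = ⊥-elim (prime∤1 q-prime (gap-coprime (P₋ i) ε₀ (p∣P₋ i j j≢i) q∣gap))

  gap-P₋-power : ∀ i → ∃ λ e → gap (P₋ i) ε₀ ≡ p i ^ e
  gap-P₋-power i = only-prime-divisor⇒power (gap (P₋ i) ε₀)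
    {{>-nonZero (≤-trans (pred-mono-≤ (P₋≥2 i)) (gap≥pred (P₋ i) ε₀))}} (radical-co-singleton i)

  -- p₁ = 2: one of a₁ and |a₁ - ε₀| is even, so 2 ∈ 𝔓, and p₁ is the least prime of 𝔓
  2∈𝔓 : ∃ (λ j → 2 ≡ p j)
  2∈𝔓 with 2 ∣? a i₁
  ... | yes 2∣a = i₁ , prime∣prime⇒≡ prime[2] (p-prime i₁) (prime∣^⇒∣ (p i₁) (v i₁) prime[2] 2∣a)
  ... | no  2∤a = radical-singleton i₁ 2 prime[2] (odd⇒2∣gap (a i₁) ε₀ 2∤a)

  p₁≡2 : p i₁ ≡ 2
  p₁≡2 with 2∈𝔓
  ... | j , 2≡pⱼ = ≤-antisym (subst (p i₁ ≤_) (sym 2≡pⱼ) (p₁-least j)) (p≥2 i₁)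

  p₂≥3 : 3 ≤ p i₂
  p₂≥3 = subst (_< p i₂) p₁≡2 (p-increasing i₁ i₂ (s≤s z≤n))

  p-odd : ∀ j → ¬ 2 ∣ p (suc j)
  p-odd j 2∣p = <⇒≢ (subst (_< p (suc j)) p₁≡2 (p-increasing zero (suc j) (s≤s z≤n)))
                    (prime∣prime⇒≡ prime[2] (p-prime (suc j)) 2∣p)

  module ThreeNotInP (3∉𝔓 : ∀ j → p j ≢ 3) where

    3∤a : ∀ i → ¬ 3 ∣ a i
    3∤a i 3∣a = 3∉𝔓 i (sym (prime∣prime⇒≡ prime[3] (p-prime i) (prime∣^⇒∣ (p i) (v i) prime[3] 3∣a)))

    3∤gap-a : ∀ i → ¬ 3 ∣ gap (a i) ε₀
    3∤gap-a i 3∣gap with radical-singleton i 3 prime[3] 3∣gap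
    ... | j , 3≡pⱼ = 3∉𝔓 j (sym 3≡pⱼ)

    3∤gap-∁J : ¬ 3 ∣ gap (P p v (∁ J)) ε₀
    3∤gap-∁J 3∣gap with radical-∁J 3 prime[3] 3∣gap
    ... | j , 3≡pⱼ = 3∉𝔓 j (sym 3≡pⱼ)

    -- ε₀ = +1: all aᵢ ≡ 2 (mod 3), so P_{∁J} ≡ 2^{|∁J|} ≡ 1 (mod 3) and 3 ∣ P_{∁J} - 1
    plus-absurd : ε₀ ≡ Sign.+ → ⊥
    plus-absurd refl = 3∤gap-∁J (%≡1⇒∣gap+ 3 (P p v (∁ J)) P∁J≡1)
      where
      a≡2 : ∀ i → a i % 3 ≡ 2
      a≡2 i with residue-mod3 (a i)
      ... | inj₁ a≡0        = ⊥-elim (3∤a i (m%n≡0⇒n∣m (a i) 3 a≡0))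
      ... | inj₂ (inj₁ a≡1) = ⊥-elim (3∤gap-a i (%≡1⇒∣gap+ 3 (a i) a≡1))
      ... | inj₂ (inj₂ a≡2) = a≡2
      P∁J≡1 : P p v (∁ J) % 3 ≡ 1
      P∁J≡1 = trans (P-mod 3 2 p v (∁ J) (λ i _ → a≡2 i)) (even⇒2^%3≡1 _ ∁J-even)

    -- ε₀ = -1: all aᵢ ≡ 1 (mod 3); as P₋ᵢ + 1 = pᵢ^e ≡ 2 (mod 3), all pᵢ ≡ 2 (mod 3),
    -- so all vᵢ are even and aᵢ ≡ 1 (mod 8) for i ≠ 1; then P₋₁ + 1 = 2^e ≡ 2 (mod 8)
    -- forces P₋₁ = 1, contradicting P₋₁ ≥ 2
    minus-absurd : ε₀ ≡ Sign.- → ⊥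
    minus-absurd refl = <⇒≢ (P₋≥2 i₁) (sym P₋₁≡1)
      where
      a≡1 : ∀ i → a i % 3 ≡ 1
      a≡1 i with residue-mod3 (a i)
      ... | inj₁ a≡0        = ⊥-elim (3∤a i (m%n≡0⇒n∣m (a i) 3 a≡0))
      ... | inj₂ (inj₁ a≡1) = a≡1
      ... | inj₂ (inj₂ a≡2) = ⊥-elim (3∤gap-a i (%3≡2⇒3∣gap- (a i) a≡2))

      1+P₋-power : ∀ i → ∃ λ e → suc (P₋ i) ≡ p i ^ e
      1+P₋-power i with gap-P₋-power i
      ... | e , gap≡pᵉ = e , trans (sym (gap-minus (P₋ i))) gap≡pᵉ

      1+P₋≡2 : ∀ i → suc (P₋ i) % 3 ≡ 2
      1+P₋≡2 i = %-+-cong 3 {1} {1} {P₋ i} {1} refl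
        (P-mod-1 3 p v (∁ ⁅ i ⁆) (λ j _ → a≡1 j))

      p≡2 : ∀ i → p i % 3 ≡ 2
      p≡2 i with residue-mod3 (p i) | 1+P₋-power i
      ... | inj₁ p≡0        | _ = ⊥-elim (3∉𝔓 i (sym (prime∣prime⇒≡ prime[3] (p-prime i) (m%n≡0⇒n∣m (p i) 3 p≡0))))
      ... | inj₂ (inj₁ p≡1) | e , 1+P₋≡pᵉ =
        contradiction (trans (sym (1+P₋≡2 i)) (trans (cong (_% 3) 1+P₋≡pᵉ) (%≡1⇒^%≡1 3 e p≡1))) λ ()
      ... | inj₂ (inj₂ p≡2) | _ = p≡2

      v-even : ∀ i → 2 ∣ v i
      v-even i = 2^%3≡1⇒even (v i) (trans (sym (%-^-cong 3 {p i} {2} (v i) (p≡2 i))) (a≡1 i))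

      a≡1-mod8 : ∀ i → i ∈ ∁ ⁅ i₁ ⁆ → a i % 8 ≡ 1
      a≡1-mod8 zero    1∈ = ⊥-elim (x∈∁p⇒x∉p 1∈ (x∈⁅x⁆ zero))
      a≡1-mod8 (suc j) _  = odd^even%8≡1 (p (suc j)) (v (suc j)) (p-odd j) (v-even (suc j))

      1+P₋₁≡2-mod8 : suc (P₋ i₁) % 8 ≡ 2
      1+P₋₁≡2-mod8 = %-+-cong 8 {1} {1} {P₋ i₁} {1} refl
        (P-mod-1 8 p v (∁ ⁅ i₁ ⁆) a≡1-mod8)

      P₋₁≡1 : P₋ i₁ ≡ 1
      P₋₁≡1 with 1+P₋-power i₁
      ... | e , 1+P₋₁≡pᵉ = suc-injective (trans 1+P₋₁≡2ᵉ (cong (2 ^_) e≡1))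
        where
        1+P₋₁≡2ᵉ : suc (P₋ i₁) ≡ 2 ^ e
        1+P₋₁≡2ᵉ = trans 1+P₋₁≡pᵉ (cong (_^ e) p₁≡2)
        e≡1 : e ≡ 1
        e≡1 = 2^%8≡2⇒≡1 e (subst (λ x → x % 8 ≡ 2) 1+P₋₁≡2ᵉ 1+P₋₁≡2-mod8)

    contradiction-from-sign : ∀ s → ε₀ ≡ s → ⊥
    contradiction-from-sign Sign.+ = plus-absurd
    contradiction-from-sign Sign.- = minus-absurd

  -- p₂ = 3: otherwise 3 ∉ 𝔓 (p₁ = 2 < 3 < p₂ < p₃ < ⋯)
  p₂≡3 : p i₂ ≡ 3
  p₂≡3 with p i₂ ≟ 3
  ... | yes p₂≡3 = p₂≡3
  ... | no  p₂≢3 = ⊥-elim (ThreeNotInP.contradiction-from-sign 3∉𝔓 ε₀ refl)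
    where
    3∉𝔓 : ∀ j → p j ≢ 3
    3∉𝔓 zero             p₁≡3 = contradiction (trans (sym p₁≡2) p₁≡3) λ ()
    3∉𝔓 (suc zero)       p₂≡3 = p₂≢3 p₂≡3
    3∉𝔓 (suc (suc j))    pⱼ≡3 = <⇒≱ (subst (p i₂ <_) pⱼ≡3 (p-increasing i₂ (suc (suc j)) (s≤s (s≤s z≤n)))) p₂≥3

  p₃≥5 : 5 ≤ p i₃
  p₃≥5 with p i₃ ≟ 4
  ... | yes p₃≡4 = ⊥-elim (p-odd (suc zero) (subst (2 ∣_) (sym p₃≡4) (divides 2 refl)))
  ... | no  p₃≢4 = ≤∧≢⇒< (subst (_< p i₃) p₂≡3 (p-increasing i₂ i₃ (s≤s (s≤s z≤n)))) (p₃≢4 ∘ sym)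

  P₋₂≥5 : 5 ≤ P₋ i₂
  P₋₂≥5 = ≤-trans p₃≥5 (p≤P₋ i₂ i₃ λ ())

  P₋₂≢8 : P₋ i₂ ≢ 8
  P₋₂≢8 P₋₂≡8 = <⇒≱ (≤-trans (s≤s (s≤s (s≤s z≤n))) p₃≥5)
    (∣⇒≤ (prime∣^⇒∣ 2 3 (p-prime i₃) (subst (p i₃ ∣_) P₋₂≡8 (p∣P₋ i₂ i₃ λ ()))))

  gap-P₋₂≡3^α : ∀ α → IsExponent 3 α (gap (P₋ i₂) ε₀) → gap (P₋ i₂) ε₀ ≡ 3 ^ α
  gap-P₋₂≡3^α α α-exponent with gap-P₋-power i₂
  ... | e , gap≡p₂ᵉ = trans gap≡3ᵉ (cong (3 ^_) (sym α≡e))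
    where
    gap≡3ᵉ : gap (P₋ i₂) ε₀ ≡ 3 ^ e
    gap≡3ᵉ = trans gap≡p₂ᵉ (cong (_^ e) p₂≡3)
    α≡e : α ≡ e
    α≡e = exponent-of-power (s≤s (s≤s z≤n)) (subst (IsExponent 3 α) gap≡3ᵉ α-exponent)

  exponent-bound : ∀ α → IsExponent (p i₂) α (gap (P₋ i₂) (ε (∁ ⁅ i₂ ⁆))) → + 5 - sgn ε₀ ≤ℤ + 2 *ℤ + α
  exponent-bound α α-exponent = power-of-3-bound (P₋ i₂) ε₀ α P₋₂≥5 P₋₂≢8 (gap-P₋₂≡3^α α
    (subst₂ (λ q s → IsExponent q α (gap (P₋ i₂) s)) p₂≡3 (ε-co-singleton i₂) α-exponent))

lemma4 : (n : ℕ) → (n≥3 : 3 ≤ n)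
    → (p : Fin n → ℕ) → (v : Fin n → ℕ)
    → (D : Subset n → Set) → (ε : Subset n → Sign)
    → (∀ i → Prime (p i))
    → (∀ i j → i <ᶠ j → p i < p j)
    → (∀ i → 1 ≤ v i)
    → (∀ I → D I → NonemptyProper I)
    → ∃ (λ I → D I)
    → (∀ I → D I → ∀ q → Prime q → q ∣ Data.Integer.∣ Pminus p v ε I ∣ → ∃ (λ i → q ≡ p i))
    → (∀ I → D I → Data.Fin.Subset.∣ I ∣ ≡ 1 → D (∁ I))
    → (∀ I → D I → Data.Fin.Subset.∣ I ∣ ≡ 1 → ε I ≡ ε (∁ I))
    → (J : Subset n) → (ε₀ : Sign)
    → NonemptyProper J
    → 2 ∣ Data.Fin.Subset.∣ ∁ J ∣
    → (∀ i → D ⁅ i ⁆)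
    → D (∁ J)
    → (∀ i → ε ⁅ i ⁆ ≡ ε₀)
    → ε (∁ J) ≡ ε₀
    → p (second n≥3) ≡ 3
      × (∀ α → IsExponent (p (second n≥3)) α Data.Integer.∣ Pminus p v ε (∁ ⁅ second n≥3 ⁆) ∣
           → + 5 - sgn ε₀ ≤ℤ + 2 *ℤ + α)
lemma4 (suc (suc (suc k))) (s≤s (s≤s (s≤s _))) p v D ε p-prime p-increasing v≥1 _ _ radical
       D-co ε-co J ε₀ _ ∁J-even D-singleton D-∁J ε-singleton ε-∁J =
  p₂≡3 , exponent-bound
  where
  open Setting k p v D ε p-prime p-increasing v≥1 radical D-co ε-co J ε₀ ∁J-even
               D-singleton D-∁J ε-singleton ε-∁J
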